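{- A cyclic 3-vertex quiver $Q$ with large weights has at most one descent. If $Q$ has a descent, then it is unique and is the vertex opposite the (necessarily unique) maximum weight, i.e. the vertex $i$ such that $|b_{jk}(Q)|$ is the maximum weight, where $\{i,j,k\}$ is the vertex set. Moreover, if $Q$ has a descent, then the other two vertices are ascents.
   Context: A quiver on $\{i,j,k\}$ is encoded by a skew-symmetric matrix $B(Q)=(b_{uv})$, $b_{uv}>0$ meaning $b_{uv}$ arrows from $u$ to $v$; mutation at $m$: $b'_{uv}=-b_{uv}$ if $m\in\{u,v\}$, else $b'_{uv}=b_{uv}+\tfrac12(|b_{um}|b_{mv}+b_{um}|b_{mv}|)$. The weight between $u,v$ is $|b_{uv}|$; large weights means all weights are $\ge 2$. A 3-vertex quiver is cyclic if it contains an oriented 3-cycle. Vertex $i$ is an ascent (resp. descent) if $|b_{jk}(\mu[i](Q))|>|b_{jk}(Q)|$ (resp. $<$). -}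

module Defs where

open import Data.Nat using (ℕ; _<_; _≤_; _>_)
open import Data.Integer using (ℤ; +_; -_; _+_; _*_; ∣_∣) renaming (_<_ to _<ℤ_)
open import Data.Integer.DivMod using (_/_)
open import Data.Fin using (Fin)
open import Data.Product using (∃; Σ; _×_; ∃-syntax)
open import Relation.Binary.PropositionalEquality using (_≡_; _≢_)

V : Set
V = Fin 3

-- Exchange matrix of a quiver: b u v > 0 means b u v arrows u → v.
Mat : Set
Mat = V → V → ℤ

SkewSym : Mat → Set
SkewSym B = ∀ u v → B v u ≡ - B u v

-- Three pairwise distinct vertices (i.e. {u,v,w} is the whole vertex set).
Distinct3 : V → V → V → Set
Distinct3 u v w = u ≢ v × v ≢ w × u ≢ w

-- ½ (|a| b + a |b|)  (the numerator is always even, so division is exact)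
halfTerm : ℤ → ℤ → ℤ
halfTerm a c = ((+ ∣ a ∣) * c + a * (+ ∣ c ∣)) / (+ 2)

open import Data.Fin using (_≟_)
open import Relation.Nullary using (yes; no)

mutate : V → Mat → Mat
mutate m B u v with u ≟ m | v ≟ m
... | yes _ | _     = - B u v
... | no _  | yes _ = - B u v
... | no _  | no _  = B u v + halfTerm (B u m) (B m v)

weight : Mat → V → V → ℕ
weight B u v = ∣ B u v ∣

LargeWeights : Mat → Set
LargeWeights B = ∀ u v → u ≢ v → 2 ≤ weight B u v

Cyclic : Mat → Set
Cyclic B = ∃[ u ] ∃[ v ] ∃[ w ]
  (Distinct3 u v w × (+ 0 <ℤ B u v) × (+ 0 <ℤ B v w) × (+ 0 <ℤ B w u))

Ascent : Mat → V → Set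
Ascent B i = ∀ j k → Distinct3 i j k → weight B j k < weight (mutate i B) j k

Descent : Mat → V → Set
Descent B i = ∀ j k → Distinct3 i j k → weight (mutate i B) j k < weight B j k

-- Along an oriented triangle x → y → z → x with a, b, c arrows, mutation at x replaces
-- the weight b of the opposite side by |b − ac|.  So x is a descent iff ac < 2b and an
-- ascent iff ac > 2b.  With all weights ≥ 2, ac < 2b forces a, c < b, and
-- 2c ≤ ac < 2b ≤ ab and 2a ≤ ac < 2b ≤ cb say that y and z are ascents, so no
-- other vertex is a descent.
module Submission where

open import Data.Nat as ℕ using (ℕ; suc; _<_; _≤_)
import Data.Nat.Properties as ℕ
import Data.Nat.DivMod as ℕ
open import Data.Integer as ℤ using (+_; -[1+_]; -_; _+_; _*_; _⊖_; ∣_∣) renaming (_<_ to _<ℤ_)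
open import Data.Integer.DivMod using (_/_)
import Data.Integer.Properties as ℤ
open import Data.Fin using (_≟_)
open import Data.Fin.Properties using (all?)
open import Data.Product using (_×_; _,_; proj₁; proj₂; ∃-syntax)
open import Data.Sum using (_⊎_; inj₁; inj₂)
open import Relation.Nullary using (Dec; yes; no; ¬_; ¬?; contradiction)
open import Relation.Nullary.Decidable using (from-yes; _×-dec_; _⊎-dec_; _→-dec_)
open import Relation.Binary.PropositionalEquality

open import Defs

distinct3? : ∀ x y z → Dec (Distinct3 x y z)
distinct3? x y z = ¬? (x ≟ y) ×-dec ¬? (y ≟ z) ×-dec ¬? (x ≟ z)

Distinct3-rotate : ∀ {x y z} → Distinct3 x y z → Distinct3 y z x
Distinct3-rotate (x≢y , y≢z , x≢z) = y≢z , (λ z≡x → x≢z (sym z≡x)) , (λ y≡x → x≢y (sym y≡x))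

-- Both facts are decided by evaluation over Fin 3; opaque keeps with-abstractions from
-- unfolding that search.
opaque
  Distinct3-covers : ∀ x y z w → Distinct3 x y z → w ≡ x ⊎ w ≡ y ⊎ w ≡ z
  Distinct3-covers = from-yes (all? λ x → all? λ y → all? λ z → all? λ w →
    distinct3? x y z →-dec (w ≟ x ⊎-dec w ≟ y ⊎-dec w ≟ z))

  Distinct3-complement : ∀ x y z j k → Distinct3 x y z → Distinct3 x j k →
    (j ≡ y × k ≡ z) ⊎ (j ≡ z × k ≡ y)
  Distinct3-complement = from-yes (all? λ x → all? λ y → all? λ z → all? λ j → all? λ k →
    distinct3? x y z →-dec distinct3? x j k →-dec ((j ≟ y ×-dec k ≟ z) ⊎-dec (j ≟ z ×-dec k ≟ y)))

n+n≡2*n : ∀ n → n ℕ.+ n ≡ 2 ℕ.* n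
n+n≡2*n n = cong (n ℕ.+_) (sym (ℕ.+-identityʳ n))

∣m⊖n∣<m⇒n<2*m : ∀ m n → ∣ m ⊖ n ∣ < m → n < 2 ℕ.* m
∣m⊖n∣<m⇒n<2*m m n h with ℕ.≤-total n m
... | inj₁ n≤m = subst (n <_) (n+n≡2*n m) (ℕ.≤-<-trans n≤m (ℕ.m<m+n m (ℕ.≤-<-trans ℕ.z≤n h)))
... | inj₂ m≤n = begin-strict
  n                ≡⟨ ℕ.m∸n+n≡m m≤n ⟨
  n ℕ.∸ m ℕ.+ m    <⟨ ℕ.+-monoˡ-< m (subst (_< m) (ℤ.∣⊖∣-≤ m≤n) h) ⟩
  m ℕ.+ m          ≡⟨ n+n≡2*n m ⟩
  2 ℕ.* m          ∎
  where open ℕ.≤-Reasoning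

2*m<n⇒m<∣m⊖n∣ : ∀ m n → 2 ℕ.* m < n → m < ∣ m ⊖ n ∣
2*m<n⇒m<∣m⊖n∣ m n h = begin-strict
  m                        ≡⟨ ℕ.m+n∸m≡n m m ⟨
  m ℕ.+ m ℕ.∸ m            <⟨ ℕ.∸-monoˡ-< m+m<n (ℕ.m≤m+n m m) ⟩
  n ℕ.∸ m                  ≡⟨ ℤ.∣⊖∣-≤ (ℕ.≤-trans (ℕ.m≤m+n m m) (ℕ.<⇒≤ m+m<n)) ⟨
  ∣ m ⊖ n ∣                ∎
  where
  open ℕ.≤-Reasoning
  m+m<n : m ℕ.+ m < n
  m+m<n = subst (_< n) (sym (n+n≡2*n m)) h

m*n<2*o⇒m<o : ∀ m n o → 2 ≤ n → m ℕ.* n < 2 ℕ.* o → m < o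
m*n<2*o⇒m<o m n o 2≤n h = ℕ.*-cancelʳ-< n m o (begin-strict
  m ℕ.* n   <⟨ h ⟩
  2 ℕ.* o   ≤⟨ ℕ.*-monoˡ-≤ o 2≤n ⟩
  n ℕ.* o   ≡⟨ ℕ.*-comm n o ⟩
  o ℕ.* n   ∎)
  where open ℕ.≤-Reasoning

m*n<2*o⇒2*n<o*m : ∀ m n o → 2 ≤ m → m ℕ.* n < 2 ℕ.* o → 2 ℕ.* n < o ℕ.* m
m*n<2*o⇒2*n<o*m m n o 2≤m h = begin-strict
  2 ℕ.* n   ≤⟨ ℕ.*-monoˡ-≤ n 2≤m ⟩
  m ℕ.* n   <⟨ h ⟩
  2 ℕ.* o   ≤⟨ ℕ.*-monoˡ-≤ o 2≤m ⟩
  m ℕ.* o   ≡⟨ ℕ.*-comm m o ⟩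
  o ℕ.* m   ∎
  where open ℕ.≤-Reasoning

[n+n]/2≡n : ∀ n → (n ℕ.+ n) ℕ./ 2 ≡ n
[n+n]/2≡n n = trans (cong (ℕ._/ 2) (trans (n+n≡2*n n) (ℕ.*-comm 2 n))) (ℕ.m*n/n≡m n 2)

[n+n]%2≡0 : ∀ n → (n ℕ.+ n) ℕ.% 2 ≡ 0
[n+n]%2≡0 n = trans (cong (ℕ._% 2) (trans (n+n≡2*n n) (ℕ.*-comm 2 n))) (ℕ.m*n%n≡0 n 2)

-- The integer division rounds towards −∞, so the negative case needs the remainder to vanish.
[2+n+n]%2≡0 : ∀ n → suc (suc (n ℕ.+ n)) ℕ.% 2 ≡ 0
[2+n+n]%2≡0 n = trans (cong (λ m → suc m ℕ.% 2) (sym (ℕ.+-suc n n))) ([n+n]%2≡0 (suc n))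

[i+i]/2≡i : ∀ i → (i + i) / + 2 ≡ i
[i+i]/2≡i (+ n) = trans (ℤ.*-identityˡ _) (cong +_ ([n+n]/2≡n n))
[i+i]/2≡i -[1+ n ] rewrite [2+n+n]%2≡0 n = trans (ℤ.*-identityˡ _)
  (cong (λ m → - + m) (trans (cong (λ m → suc m ℕ./ 2) (sym (ℕ.+-suc n n))) ([n+n]/2≡n (suc n))))

halfTerm-+ : ∀ a c → halfTerm (+ a) (+ c) ≡ + (a ℕ.* c)
halfTerm-+ a c = trans ([i+i]/2≡i (+ a * + c)) (sym (ℤ.pos-* a c))

halfTerm-- : ∀ a c → halfTerm (- + a) (- + c) ≡ - + (a ℕ.* c)
halfTerm-- a c = begin
  (+ ∣ - + a ∣ * - + c + - + a * + ∣ - + c ∣) / + 2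
    ≡⟨ cong₂ (λ m n → (+ m * - + c + - + a * + n) / + 2) (ℤ.∣-i∣≡∣i∣ (+ a)) (ℤ.∣-i∣≡∣i∣ (+ c)) ⟩
  (+ a * - + c + - + a * + c) / + 2
    ≡⟨ cong₂ (λ i j → (i + j) / + 2) (ℤ.neg-distribʳ-* (+ a) (+ c)) (ℤ.neg-distribˡ-* (+ a) (+ c)) ⟨
  (- (+ a * + c) + - (+ a * + c)) / + 2
    ≡⟨ [i+i]/2≡i (- (+ a * + c)) ⟩
  - (+ a * + c)
    ≡⟨ cong -_ (ℤ.pos-* a c) ⟨
  - + (a ℕ.* c) ∎
  where open ≡-Reasoning

weight-skew : ∀ {B} → SkewSym B → ∀ u v → weight B v u ≡ weight B u v
weight-skew {B} skew u v = trans (cong ∣_∣ (skew u v)) (ℤ.∣-i∣≡∣i∣ (B u v))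

mutate-apart : ∀ m B {u v} → u ≢ m → v ≢ m → mutate m B u v ≡ B u v + halfTerm (B u m) (B m v)
mutate-apart m B {u} {v} u≢m v≢m with u ≟ m | v ≟ m
... | yes u≡m | _       = contradiction u≡m u≢m
... | no _    | yes v≡m = contradiction v≡m v≢m
... | no _    | no _    = refl

Ascent⇒¬Descent : ∀ {B x y z} → Distinct3 x y z → Ascent B x → ¬ Descent B x
Ascent⇒¬Descent {y = y} {z} d ascent descent = ℕ.<-asym (ascent y z d) (descent y z d)

OrientedCycle : Mat → V → V → V → Set
OrientedCycle B x y z = Distinct3 x y z × (+ 0 <ℤ B x y) × (+ 0 <ℤ B y z) × (+ 0 <ℤ B z x)

OrientedCycle-rotate : ∀ {B x y z} → OrientedCycle B x y z → OrientedCycle B y z x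
OrientedCycle-rotate (d , xy , yz , zx) = Distinct3-rotate d , yz , zx , xy

OrientedCycle-through : ∀ {B} → Cyclic B → ∀ i → ∃[ y ] ∃[ z ] OrientedCycle B i y z
OrientedCycle-through (u , v , w , cycle) i with Distinct3-covers u v w i (proj₁ cycle)
... | inj₁ refl        = v , w , cycle
... | inj₂ (inj₁ refl) = w , u , OrientedCycle-rotate cycle
... | inj₂ (inj₂ refl) = u , v , OrientedCycle-rotate (OrientedCycle-rotate cycle)

record Triangle (B : Mat) (x y z : V) (a b c : ℕ) : Set where
  field
    distinct : Distinct3 x y z
    xy≡a : B x y ≡ + a
    yz≡b : B y z ≡ + b
    zx≡c : B z x ≡ + c

  y≢x : y ≢ x
  y≢x y≡x = proj₁ distinct (sym y≡x)

  z≢x : z ≢ x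
  z≢x z≡x = proj₂ (proj₂ distinct) (sym z≡x)

  weight-xy : weight B x y ≡ a
  weight-xy = cong ∣_∣ xy≡a

  weight-yz : weight B y z ≡ b
  weight-yz = cong ∣_∣ yz≡b

  weight-zx : weight B z x ≡ c
  weight-zx = cong ∣_∣ zx≡c

Triangle-rotate : ∀ {B x y z a b c} → Triangle B x y z a b c → Triangle B y z x b c a
Triangle-rotate t = record
  { distinct = Distinct3-rotate distinct ; xy≡a = yz≡b ; yz≡b = zx≡c ; zx≡c = xy≡a }
  where open Triangle t

OrientedCycle⇒Triangle : ∀ {B x y z} → OrientedCycle B x y z →
  Triangle B x y z (weight B x y) (weight B y z) (weight B z x)
OrientedCycle⇒Triangle (d , xy , yz , zx) = record
  { distinct = d ; xy≡a = ≡+∣∣ xy ; yz≡b = ≡+∣∣ yz ; zx≡c = ≡+∣∣ zx }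
  where
  ≡+∣∣ : ∀ {i} → + 0 <ℤ i → i ≡ + ∣ i ∣
  ≡+∣∣ 0<i = sym (ℤ.0≤i⇒+∣i∣≡i (ℤ.<⇒≤ 0<i))

module _ (B : Mat) (skew : SkewSym B) where

  weight-mutate-yz : ∀ {x y z a b c} → Triangle B x y z a b c →
    weight (mutate x B) y z ≡ ∣ b ⊖ a ℕ.* c ∣
  weight-mutate-yz {x} {y} {z} {a} {b} {c} t
    rewrite mutate-apart x B (Triangle.y≢x t) (Triangle.z≢x t) | skew x y | skew z x
          | Triangle.xy≡a t | Triangle.yz≡b t | Triangle.zx≡c t | halfTerm-- a c
    = cong ∣_∣ (ℤ.m-n≡m⊖n b (a ℕ.* c))

  weight-mutate-zy : ∀ {x y z a b c} → Triangle B x y z a b c →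
    weight (mutate x B) z y ≡ ∣ b ⊖ a ℕ.* c ∣
  weight-mutate-zy {x} {y} {z} {a} {b} {c} t
    rewrite mutate-apart x B (Triangle.z≢x t) (Triangle.y≢x t) | skew y z
          | Triangle.xy≡a t | Triangle.yz≡b t | Triangle.zx≡c t | halfTerm-+ c a = begin
      ∣ - + b + + (c ℕ.* a) ∣   ≡⟨ cong ∣_∣ (ℤ.-m+n≡n⊖m b (c ℕ.* a)) ⟩
      ∣ c ℕ.* a ⊖ b ∣           ≡⟨ ℤ.∣m⊖n∣≡∣n⊖m∣ (c ℕ.* a) b ⟩
      ∣ b ⊖ c ℕ.* a ∣           ≡⟨ cong (λ n → ∣ b ⊖ n ∣) (ℕ.*-comm c a) ⟩
      ∣ b ⊖ a ℕ.* c ∣           ∎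
    where open ≡-Reasoning

  Descent⇒*<2* : ∀ {x y z a b c} → Triangle B x y z a b c → Descent B x → a ℕ.* c < 2 ℕ.* b
  Descent⇒*<2* {y = y} {z} {a} {b} {c} t descent = ∣m⊖n∣<m⇒n<2*m b (a ℕ.* c)
    (subst₂ _<_ (weight-mutate-yz t) weight-yz (descent y z distinct))
    where open Triangle t

  2*<*⇒Ascent : ∀ {x y z a b c} → Triangle B x y z a b c → 2 ℕ.* b < a ℕ.* c → Ascent B x
  2*<*⇒Ascent {x} {y} {z} {a} {b} {c} t 2b<ac j k d
    with Distinct3-complement x y z j k (Triangle.distinct t) d
  ... | inj₁ (refl , refl) =
    subst₂ _<_ (sym (Triangle.weight-yz t)) (sym (weight-mutate-yz t)) (2*m<n⇒m<∣m⊖n∣ b (a ℕ.* c) 2b<ac)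
  ... | inj₂ (refl , refl) =
    subst₂ _<_ (sym (trans (weight-skew skew y z) (Triangle.weight-yz t))) (sym (weight-mutate-zy t))
      (2*m<n⇒m<∣m⊖n∣ b (a ℕ.* c) 2b<ac)

  descent-forces : LargeWeights B → ∀ {x y z a b c} → Triangle B x y z a b c → Descent B x →
    a < b × c < b × Ascent B y × Ascent B z
  descent-forces large {x} {y} {z} {a} {b} {c} t descent =
      m*n<2*o⇒m<o a c b 2≤c ac<2b
    , m*n<2*o⇒m<o c a b 2≤a ca<2b
    , 2*<*⇒Ascent (Triangle-rotate t) (m*n<2*o⇒2*n<o*m a c b 2≤a ac<2b)
    , 2*<*⇒Ascent (Triangle-rotate (Triangle-rotate t))
        (subst (2 ℕ.* a <_) (ℕ.*-comm b c) (m*n<2*o⇒2*n<o*m c a b 2≤c ca<2b))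
    where
    open Triangle t
    ac<2b : a ℕ.* c < 2 ℕ.* b
    ac<2b = Descent⇒*<2* t descent
    ca<2b : c ℕ.* a < 2 ℕ.* b
    ca<2b = subst (_< 2 ℕ.* b) (ℕ.*-comm a c) ac<2b
    2≤a : 2 ≤ a
    2≤a = subst (2 ≤_) weight-xy (large x y (proj₁ distinct))
    2≤c : 2 ≤ c
    2≤c = subst (2 ≤_) weight-zx (large z x z≢x)

  descent-at-cycle : LargeWeights B → ∀ {x y z} → OrientedCycle B x y z → Descent B x →
    weight B x y < weight B y z × weight B x z < weight B y z × Ascent B y × Ascent B z
  descent-at-cycle large {x} {y} {z} cycle descent =
    let a<b , c<b , ascent-y , ascent-z = descent-forces large (OrientedCycle⇒Triangle cycle) descent
    in a<b , subst (_< weight B y z) (sym (weight-skew skew z x)) c<b , ascent-y , ascent-z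

lemma3p6 : (B : Mat) → SkewSym B → Cyclic B → LargeWeights B →
    ((i i′ : V) → Descent B i → Descent B i′ → i ≡ i′) ×
    ((i j k : V) → Distinct3 i j k → Descent B i →
      (weight B i j < weight B j k) × (weight B i k < weight B j k) ×
      Ascent B j × Ascent B k)
lemma3p6 B skew cyclic large = descent-unique , descent-shape
  where
  descent-unique : (i i′ : V) → Descent B i → Descent B i′ → i ≡ i′
  descent-unique i i′ di di′ with OrientedCycle-through cyclic i
  ... | y , z , cycle@(d , _) with Distinct3-covers i y z i′ d
  ...   | inj₁ i′≡i = sym i′≡i
  ...   | inj₂ (inj₁ refl) =
    let _ , _ , ascent-y , _ = descent-at-cycle B skew large cycle di
    in contradiction di′ (Ascent⇒¬Descent (Distinct3-rotate d) ascent-y)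
  ...   | inj₂ (inj₂ refl) =
    let _ , _ , _ , ascent-z = descent-at-cycle B skew large cycle di
    in contradiction di′ (Ascent⇒¬Descent (Distinct3-rotate (Distinct3-rotate d)) ascent-z)

  descent-shape : (i j k : V) → Distinct3 i j k → Descent B i →
    (weight B i j < weight B j k) × (weight B i k < weight B j k) × Ascent B j × Ascent B k
  descent-shape i j k dijk di with OrientedCycle-through cyclic i
  ... | y , z , cycle@(d , _) with Distinct3-complement i y z j k d dijk
  ...   | inj₁ (refl , refl) = descent-at-cycle B skew large cycle di
  ...   | inj₂ (refl , refl) =
    let iy<yz , iz<yz , ascent-y , ascent-z = descent-at-cycle B skew large cycle di
        zy≡yz = weight-skew skew y z
    in subst (weight B i z <_) (sym zy≡yz) iz<yz , subst (weight B i y <_) (sym zy≡yz) iy<yz ,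
       ascent-z , ascent-y
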